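{- Let $G$ be a finite graph with vertex set $V$, and let $\leq$ be a tree order on $V$ such that $(G,\leq)$ is a lefthanded graph. Suppose each vertex $v$ is labeled with a real number $0\leq p_v\leq 1$, and for $S\subseteq V$ define \[ \sigma(S):=\sum_{\substack{I\supseteq S\\ I\text{ independent in } G}}(-1)^{|I|-|S|}\prod_{v\in I}p_v . \] If $\sigma(S)\geq 0$ for all $S\subseteq V$ and $\sigma(\emptyset)>0$, then there is an assignment of numbers $0\leq x_v\leq 1$ ($v\in V$) such that for every $v\in V$ \[ p_v=x_v\prod_{\substack{u\sim v\\ u\leq v}}(1-x_u), \] and moreover \[ \prod_{v\in V}(1-x_v)=\sigma(\emptyset). \]
   Context: A tree order is a partial order $\leq$ in which $w\lneq u$ and $w\lneq v$ imply that $u$ and $v$ are comparable. A graph $G$ is lefthanded with respect to a tree order $\leq$ on $V(G)$ if (1) $u\sim v$ implies $u\leq v$ or $v\leq u$, and (2) whenever $w\lneq u\lneq v$ and $v\sim w$, also $v\sim u$. Here $u\sim v$ denotes adjacency in $G$, and the sum defining $\sigma(S)$ ranges over independent sets $I$ of $G$ containing $S$ (so $\sigma(S)=0$ if $S$ is not independent). -}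

module Defs where

open import Level using (0ℓ)
open import Data.Nat using (ℕ; zero; suc; _∸_)
open import Data.Bool using (Bool; true; false; not; _∧_; _∨_; if_then_else_)
open import Data.Fin using (Fin)
open import Data.Vec using (Vec; []; _∷_; lookup)
open import Data.List using (List; []; _∷_; map; _++_; foldr; allFin)
open import Data.Fin.Subset using (Subset; ∣_∣)
open import Data.Product using (_×_; ∃)
open import Data.Sum using (_⊎_)
open import Relation.Nullary using (¬_)
open import Relation.Binary.PropositionalEquality using (_≡_; _≢_)
open import Algebra.Structures using (IsCommutativeRing)
open import Relation.Binary.Structures using (IsDecTotalOrder)

-- The real numbers, axiomatised as a (Dedekind-)complete ordered field.
-- Any two such structures are isomorphic, so quantifying over all of
-- them is the same as speaking about ℝ.

record RealNumbers : Set₁ where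
  infixl 6 _+_ _-_
  infixl 7 _*_
  infix 4 _≤_ _<_
  field
    Carrier : Set
    _+_ _*_ : Carrier → Carrier → Carrier
    -_      : Carrier → Carrier
    0# 1#   : Carrier
    _≤_     : Carrier → Carrier → Set
    isCommutativeRing : IsCommutativeRing _≡_ _+_ _*_ -_ 0# 1#
    isDecTotalOrder   : IsDecTotalOrder _≡_ _≤_
    0≢1      : 0# ≢ 1#
    inverse  : ∀ x → x ≢ 0# → ∃ λ y → x * y ≡ 1#
    +-mono-≤ : ∀ x y z → x ≤ y → x + z ≤ y + z
    *-nonneg : ∀ x y → 0# ≤ x → 0# ≤ y → 0# ≤ x * y
    sup : (P : Carrier → Set) → ∃ P → (∃ λ b → ∀ x → P x → x ≤ b) →
          ∃ λ s → (∀ x → P x → x ≤ s) × (∀ b → (∀ x → P x → x ≤ b) → s ≤ b)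

  _-_ : Carrier → Carrier → Carrier
  x - y = x + (- y)

  _<_ : Carrier → Carrier → Set
  x < y = x ≤ y × x ≢ y

record Graph (n : ℕ) : Set where
  field
    adj        : Fin n → Fin n → Bool
    adj-sym    : ∀ u v → adj u v ≡ adj v u
    adj-irrefl : ∀ v → adj v v ≡ false

_∼⟨_⟩_ : ∀ {n} → Fin n → Graph n → Fin n → Set
u ∼⟨ G ⟩ v = Graph.adj G u v ≡ true

record TreeOrder (n : ℕ) : Set where
  field
    le : Fin n → Fin n → Bool

  _≤ᵗ_ : Fin n → Fin n → Set
  u ≤ᵗ v = le u v ≡ true

  _<ᵗ_ : Fin n → Fin n → Set
  u <ᵗ v = u ≤ᵗ v × u ≢ v

  field
    refl    : ∀ u → u ≤ᵗ u
    antisym : ∀ u v → u ≤ᵗ v → v ≤ᵗ u → u ≡ v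
    trans   : ∀ u v w → u ≤ᵗ v → v ≤ᵗ w → u ≤ᵗ w
    tree    : ∀ w u v → w <ᵗ u → w <ᵗ v → u ≤ᵗ v ⊎ v ≤ᵗ u

record Lefthanded {n : ℕ} (G : Graph n) (T : TreeOrder n) : Set where
  open TreeOrder T
  field
    adj-comparable : ∀ u v → u ∼⟨ G ⟩ v → u ≤ᵗ v ⊎ v ≤ᵗ u
    left           : ∀ w u v → w <ᵗ u → u <ᵗ v → v ∼⟨ G ⟩ w → v ∼⟨ G ⟩ u

allᵇ : {A : Set} → (A → Bool) → List A → Bool
allᵇ p = foldr (λ a b → p a ∧ b) true

allSubsets : (n : ℕ) → List (Subset n)
allSubsets zero    = [] ∷ []
allSubsets (suc n) = map (true ∷_) (allSubsets n) ++ map (false ∷_) (allSubsets n)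

_⊆ᵇ_ : ∀ {n} → Subset n → Subset n → Bool
_⊆ᵇ_ {n} S I = allᵇ (λ v → not (lookup S v) ∨ lookup I v) (allFin n)

independentᵇ : ∀ {n} → Graph n → Subset n → Bool
independentᵇ {n} G I =
  allᵇ (λ u → allᵇ (λ v → not (lookup I u ∧ lookup I v ∧ Graph.adj G u v)) (allFin n)) (allFin n)

module Sums (R : RealNumbers) where
  open RealNumbers R

  sign : ℕ → Carrier
  sign zero    = 1#
  sign (suc k) = - sign k

  prodWhere : ∀ {n} → (Fin n → Bool) → (Fin n → Carrier) → Carrier
  prodWhere {n} c f = foldr (λ v acc → if c v then f v * acc else acc) 1# (allFin n)

  σ : ∀ {n} → Graph n → (Fin n → Carrier) → Subset n → Carrier
  σ {n} G p S =
    foldr (λ I acc → if (S ⊆ᵇ I) ∧ independentᵇ G I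
                       then sign (∣ I ∣ ∸ ∣ S ∣) * prodWhere (lookup I) p + acc
                       else acc)
          0# (allSubsets n)

module Submission where

-- For a vertex set W write σ_W(S) for the alternating sum σ(S) restricted to
-- independent sets I ⊆ W, and Z(W) = σ_W(∅); the hypotheses concern σ = σ_V.
--
-- 1. AlternatingSums, valid for every graph: pairing each I ∌ v with I + v
--    gives the hereditary recursion σ_{W-v}(S) = σ_W(S) + σ_W(S+v), the
--    value σ_W({v}) = p_v · Z(W ∖ N[v]) and hence the deletion recurrence
--    Z(W) = Z(W-v) - p_v · Z(W ∖ N[v]).
-- 2. Positivity: adding back missing vertices one at a time, the hereditary
--    recursion turns σ_V ≥ 0 into σ_W ≥ 0 and Z(W) ≥ Z(V) > 0 for every W.
-- 3. TreeStructure and Construction: with ↓v = {u ≤ v} put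
--    x_v = 1 - Z(↓v)/Z(↓v - v).  For r maximal in a down-closed D,
--    lefthandedness splits D - r into D ∖ N[r] and the lower neighbours of r,
--    so the deletion recurrence at r yields, by strong induction on |D|,
--    both p_r = x_r ∏_{u∼r, u≤r}(1-x_u) and Z(D) = ∏_{u∈D}(1-x_u).
-- The theorem is the case D = V.

open import Defs
open import Level using (0ℓ)
open import Algebra.Bundles using (CommutativeRing)
open import Relation.Binary.Structures using (IsDecTotalOrder)
open import Data.Maybe using (nothing)
open import Tactic.RingSolver.Core.AlmostCommutativeRing using (fromCommutativeRing)
open import Data.Nat using (ℕ; zero; suc; _∸_) renaming (_≤_ to _≤ℕ_; _<_ to _<ℕ_)
import Data.Nat.Properties as ℕₚ
open import Data.Bool as Bool using (Bool; true; false; not; _∧_; _∨_; if_then_else_)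
open import Data.Bool.Properties
  using (∧-assoc; ∧-comm; ∧-zeroʳ; ∧-identityʳ; ∨-zeroʳ; ∨-identityʳ; ∧-conicalˡ; ∧-conicalʳ; ¬-not; ∨-distribˡ-∧)
open import Data.Fin using (Fin; zero; suc; _≟_)
open import Data.Fin.Properties using (any?)
open import Data.Fin.Subset using (Subset; ∣_∣; ⊥; _∈_)
open import Data.Fin.Subset.Properties using (p⊆q⇒∣p∣≤∣q∣; p⊂q⇒∣p∣<∣q∣)
open import Data.Vec using ([]; _∷_; lookup; tabulate; _[_]≔_)
open import Data.Vec.Properties
  using (lookup∘update; lookup∘update′; lookup-replicate; lookup∘tabulate; []=⇒lookup; lookup⇒[]=)
open import Data.List using (List; []; _∷_; map; _++_; foldr; allFin)
import Data.List.Properties as List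
import Data.List.Membership.Propositional as ListMem
open import Data.List.Membership.Propositional.Properties using (∈-allFin)
open import Data.List.Relation.Unary.Any using (here; there)
open import Data.Product using (_×_; ∃; _,_; proj₁; proj₂)
open import Data.Sum using (_⊎_; inj₁; inj₂)
open import Data.Empty using (⊥-elim)
open import Function using (_∘_)
open import Relation.Nullary using (yes; no; does)
open import Relation.Nullary.Decidable using (dec-true; dec-false)
open import Relation.Binary.PropositionalEquality

true-ext : ∀ {a b : Bool} → (a ≡ true → b ≡ true) → (b ≡ true → a ≡ true) → a ≡ b
true-ext {false} {false} _ _ = refl
true-ext {false} {true}  _ g = g refl
true-ext {true}  {b}     f _ = sym (f refl)

true≢false : true ≢ false
true≢false ()

separated : ∀ {A : Set} (f : A → Bool) {a b} → f a ≡ true → f b ≡ false → a ≢ b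
separated f fa fb refl = true≢false (trans (sym fa) fb)

not-true : ∀ {b} → not b ≡ true → b ≡ false
not-true {false} _ = refl

_≡ᵇ_ : ∀ {n} → Fin n → Fin n → Bool
u ≡ᵇ v = does (u ≟ v)

≡ᵇ-refl : ∀ {n} (u : Fin n) → (u ≡ᵇ u) ≡ true
≡ᵇ-refl u = dec-true (u ≟ u) refl

≡ᵇ-false : ∀ {n} {u v : Fin n} → u ≢ v → (u ≡ᵇ v) ≡ false
≡ᵇ-false {u = u} {v} = dec-false (u ≟ v)

module _ {A : Set} where
  open ListMem using () renaming (_∈_ to _∈ₗ_)

  allᵇ-sound : ∀ {q : A → Bool} xs → allᵇ q xs ≡ true → ∀ {x} → x ∈ₗ xs → q x ≡ true
  allᵇ-sound {q} (y ∷ ys) h (here refl) = ∧-conicalˡ (q y) _ h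
  allᵇ-sound {q} (y ∷ ys) h (there x∈) = allᵇ-sound ys (∧-conicalʳ (q y) _ h) x∈

  allᵇ-complete : ∀ {q : A → Bool} xs → (∀ x → q x ≡ true) → allᵇ q xs ≡ true
  allᵇ-complete []       h = refl
  allᵇ-complete (x ∷ xs) h = cong₂ _∧_ (h x) (allᵇ-complete xs h)

  allᵇ-cong : ∀ {q q' : A → Bool} → (∀ x → q x ≡ q' x) → ∀ xs → allᵇ q xs ≡ allᵇ q' xs
  allᵇ-cong h []       = refl
  allᵇ-cong h (x ∷ xs) = cong₂ _∧_ (h x) (allᵇ-cong h xs)

  allᵇ-∧ : ∀ (q q' : A → Bool) xs → allᵇ (λ x → q x ∧ q' x) xs ≡ allᵇ q xs ∧ allᵇ q' xs
  allᵇ-∧ q q' []       = refl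
  allᵇ-∧ q q' (x ∷ xs) with q x | q' x
  ... | true  | true  = allᵇ-∧ q q' xs
  ... | true  | false = sym (∧-zeroʳ (allᵇ q xs))
  ... | false | _     = refl

allᵇ-elim : ∀ {n} {q : Fin n → Bool} → allᵇ q (allFin n) ≡ true → ∀ v → q v ≡ true
allᵇ-elim {n} h v = allᵇ-sound (allFin n) h (∈-allFin v)

allᵇ-refute : ∀ {n} {q : Fin n → Bool} v → q v ≡ false → allᵇ q (allFin n) ≡ false
allᵇ-refute v qv = ¬-not (λ h → true≢false (trans (sym (allᵇ-elim h v)) qv))

-- Vertex sets are represented twice: as predicates Fin n → Bool (the sets W
-- to which sums are restricted) and as Subset n (the summation variable I).

-- I ⊆ᵖ W: every element of I satisfies W.  Note that S ⊆ᵇ I is, by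
-- definition, S ⊆ᵖ lookup I.
_⊆ᵖ_ : ∀ {n} → Subset n → (Fin n → Bool) → Bool
I ⊆ᵖ W = allᵇ (λ v → not (lookup I v) ∨ W v) (allFin _)

module _ {n : ℕ} where

  ⊆ᵖ-elim : ∀ {I : Subset n} {W} → I ⊆ᵖ W ≡ true → ∀ {u} → lookup I u ≡ true → W u ≡ true
  ⊆ᵖ-elim h {u} u∈I with allᵇ-elim h u
  ... | e rewrite u∈I = e

  ⊆ᵖ-intro : ∀ {I : Subset n} {W} → (∀ u → lookup I u ≡ true → W u ≡ true) → I ⊆ᵖ W ≡ true
  ⊆ᵖ-intro {I} {W} h = allᵇ-complete (allFin n) pointwise
    where
    pointwise : ∀ u → not (lookup I u) ∨ W u ≡ true
    pointwise u with lookup I u in u∈I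
    ... | true  = h u u∈I
    ... | false = refl

  ⊆ᵖ-cong : ∀ {I : Subset n} {W W'} → (∀ u → lookup I u ≡ true → W u ≡ W' u) → I ⊆ᵖ W ≡ I ⊆ᵖ W'
  ⊆ᵖ-cong {I} {W} {W'} h = allᵇ-cong pointwise (allFin n)
    where
    pointwise : ∀ u → not (lookup I u) ∨ W u ≡ not (lookup I u) ∨ W' u
    pointwise u with lookup I u in u∈I
    ... | true  = h u u∈I
    ... | false = refl

  ⊆ᵖ-∧ : ∀ (I : Subset n) W W' → I ⊆ᵖ (λ u → W u ∧ W' u) ≡ I ⊆ᵖ W ∧ I ⊆ᵖ W'
  ⊆ᵖ-∧ I W W' = trans (allᵇ-cong (λ u → ∨-distribˡ-∧ (not (lookup I u)) (W u) (W' u)) (allFin n))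
                       (allᵇ-∧ _ _ (allFin n))

  lookup-⊥ : ∀ (v : Fin n) → lookup ⊥ v ≡ false
  lookup-⊥ v = lookup-replicate v false

  ⊥⊆ᵖ : ∀ W → ⊥ ⊆ᵖ W ≡ true
  ⊥⊆ᵖ W = ⊆ᵖ-intro {⊥} {W} (λ u u∈⊥ → ⊥-elim (true≢false (trans (sym u∈⊥) (lookup-⊥ u))))

  ins : Fin n → Subset n → Subset n
  ins v I = I [ v ]≔ true

  lookup-ins : ∀ v u (I : Subset n) → lookup (ins v I) u ≡ (u ≡ᵇ v) ∨ lookup I u
  lookup-ins v u I with u ≟ v
  ... | yes refl = lookup∘update u I true
  ... | no u≢v   = lookup∘update′ u≢v I true

  lookup-ins-self : ∀ v (I : Subset n) → lookup (ins v I) v ≡ true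
  lookup-ins-self v I = lookup∘update v I true

  ins-cases : ∀ {v u} (I : Subset n) → lookup (ins v I) u ≡ true → u ≡ v ⊎ lookup I u ≡ true
  ins-cases {v} {u} I h with u ≟ v
  ... | yes u≡v = inj₁ u≡v
  ... | no u≢v  = inj₂ (trans (sym (lookup∘update′ u≢v I true)) h)

  ins-mono : ∀ {v u} (I : Subset n) → lookup I u ≡ true → lookup (ins v I) u ≡ true
  ins-mono {v} {u} I u∈I = trans (lookup-ins v u I) (trans (cong ((u ≡ᵇ v) ∨_) u∈I) (∨-zeroʳ _))

  ins-⊆ᵖ : ∀ v (I : Subset n) W → ins v I ⊆ᵖ W ≡ W v ∧ I ⊆ᵖ W
  ins-⊆ᵖ v I W with W v in Wv
  ... | false = allᵇ-refute v (trans (cong (λ b → not b ∨ W v) (lookup-ins-self v I)) Wv)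
  ... | true  = allᵇ-cong pointwise (allFin n)
    where
    pointwise : ∀ u → not (lookup (ins v I) u) ∨ W u ≡ not (lookup I u) ∨ W u
    pointwise u with u ≟ v
    ... | yes refl rewrite Wv = trans (∨-zeroʳ _) (sym (∨-zeroʳ _))
    ... | no u≢v   rewrite lookup∘update′ u≢v I true = refl

  ⊆ᵇ-ins : ∀ v (S I : Subset n) → lookup S v ≡ false → S ⊆ᵇ ins v I ≡ S ⊆ᵇ I
  ⊆ᵇ-ins v S I v∉S = ⊆ᵖ-cong {I = S} (λ u u∈S → lookup∘update′ (separated (lookup S) u∈S v∉S) I true)

  ∣∣-mono : ∀ {S I : Subset n} → S ⊆ᵖ lookup I ≡ true → ∣ S ∣ ≤ℕ ∣ I ∣
  ∣∣-mono {S} {I} h =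
    p⊆q⇒∣p∣≤∣q∣ {p = S} (λ {x} x∈S → lookup⇒[]= x I (⊆ᵖ-elim {S} {lookup I} h ([]=⇒lookup x∈S)))

∣ins∣ : ∀ {n} v (I : Subset n) → lookup I v ≡ false → ∣ ins v I ∣ ≡ suc ∣ I ∣
∣ins∣ zero    (false ∷ I) _  = refl
∣ins∣ (suc v) (true  ∷ I) v∉ = cong suc (∣ins∣ v I v∉)
∣ins∣ (suc v) (false ∷ I) v∉ = ∣ins∣ v I v∉

module _ {n : ℕ} where

  _⊑_ : (Fin n → Bool) → (Fin n → Bool) → Set
  D' ⊑ D = ∀ u → D' u ≡ true → D u ≡ true

  size : (Fin n → Bool) → ℕ
  size D = ∣ tabulate D ∣

  size-< : ∀ {D D' : Fin n → Bool} {r} → D' ⊑ D → D r ≡ true → D' r ≡ false → size D' <ℕ size D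
  size-< {D} {D'} {r} D'⊑D r∈D r∉D' =
    p⊂q⇒∣p∣<∣q∣ ((λ {x} x∈ → into D x (D'⊑D x (out D' x x∈))) , r , into D r r∈D ,
                 (λ r∈ → true≢false (trans (sym (out D' r r∈)) r∉D')))
    where
    out : ∀ E x → x ∈ tabulate E → E x ≡ true
    out E x x∈ = trans (sym (lookup∘tabulate E x)) ([]=⇒lookup x∈)
    into : ∀ E x → E x ≡ true → x ∈ tabulate E
    into E x Ex = lookup⇒[]= x (tabulate E) (trans (lookup∘tabulate E x) Ex)

  _─_ : (Fin n → Bool) → Fin n → (Fin n → Bool)
  (W ─ v) u = W u ∧ not (u ≡ᵇ v)

  ─-intro : ∀ {W v u} → W u ≡ true → u ≢ v → (W ─ v) u ≡ true
  ─-intro {W} {v} {u} u∈W u≢v rewrite u∈W | ≡ᵇ-false u≢v = refl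

  ─-elim : ∀ {W v u} → (W ─ v) u ≡ true → W u ≡ true × u ≢ v
  ─-elim {W} {v} {u} h with W u | u ≟ v
  ... | true | no u≢v = refl , u≢v

  ─-other : ∀ W {u v} → u ≢ v → (W ─ v) u ≡ W u
  ─-other W {u} u≢v = trans (cong (λ b → W u ∧ not b) (≡ᵇ-false u≢v)) (∧-identityʳ (W u))

  ─-⊑ : ∀ W v → (W ─ v) ⊑ W
  ─-⊑ W v u h = ∧-conicalˡ (W u) _ h

  ─-self : ∀ W v → (W ─ v) v ≡ false
  ─-self W v = trans (cong (λ b → W v ∧ not b) (≡ᵇ-refl v)) (∧-zeroʳ (W v))

module Independence {n : ℕ} (G : Graph n) where
  open Graph G using (adj; adj-sym; adj-irrefl)

  independent-elim : ∀ (I : Subset n) → independentᵇ G I ≡ true →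
                     ∀ {a b} → lookup I a ≡ true → lookup I b ≡ true → adj a b ≡ false
  independent-elim I h {a} {b} a∈I b∈I
    with allᵇ-elim {q = λ b → not (lookup I a ∧ lookup I b ∧ adj a b)}
                   (allᵇ-elim {q = λ a → allᵇ (λ b → not (lookup I a ∧ lookup I b ∧ adj a b)) (allFin n)} h a) b
  ... | e rewrite a∈I | b∈I = not-true e

  independent-intro : ∀ (I : Subset n) →
                      (∀ a b → lookup I a ≡ true → lookup I b ≡ true → adj a b ≡ false) →
                      independentᵇ G I ≡ true
  independent-intro I h = allᵇ-complete (allFin n) (λ a → allᵇ-complete (allFin n) (pointwise a))
    where
    pointwise : ∀ a b → not (lookup I a ∧ lookup I b ∧ adj a b) ≡ true
    pointwise a b with lookup I a in a∈I | lookup I b in b∈I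
    ... | false | _     = refl
    ... | true  | false = refl
    ... | true  | true  rewrite h a b a∈I b∈I = refl

  nonNeighbours : Fin n → Fin n → Bool
  nonNeighbours v u = not (adj u v)

  independent-ins : ∀ v (I : Subset n) →
                    independentᵇ G (ins v I) ≡ independentᵇ G I ∧ I ⊆ᵖ nonNeighbours v
  independent-ins v I = true-ext forward backward
    where
    forward : independentᵇ G (ins v I) ≡ true → independentᵇ G I ∧ I ⊆ᵖ nonNeighbours v ≡ true
    forward h = cong₂ _∧_
      (independent-intro I (λ a b a∈I b∈I → independent-elim (ins v I) h (ins-mono I a∈I) (ins-mono I b∈I)))
      (⊆ᵖ-intro {I = I} {W = nonNeighbours v}
        (λ a a∈I → cong not (independent-elim (ins v I) h (ins-mono I a∈I) (lookup-ins-self v I))))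
    backward : independentᵇ G I ∧ I ⊆ᵖ nonNeighbours v ≡ true → independentᵇ G (ins v I) ≡ true
    backward h = independent-intro (ins v I) adjacency
      where
      I-indep : independentᵇ G I ≡ true
      I-indep = ∧-conicalˡ _ _ h
      v-free : ∀ {a} → lookup I a ≡ true → adj a v ≡ false
      v-free a∈I = not-true (⊆ᵖ-elim {I = I} {W = nonNeighbours v} (∧-conicalʳ _ _ h) a∈I)
      adjacency : ∀ a b → lookup (ins v I) a ≡ true → lookup (ins v I) b ≡ true → adj a b ≡ false
      adjacency a b a∈ b∈ with ins-cases I a∈ | ins-cases I b∈
      ... | inj₁ refl | inj₁ refl = adj-irrefl a
      ... | inj₁ refl | inj₂ b∈I  = trans (adj-sym a b) (v-free b∈I)
      ... | inj₂ a∈I  | inj₁ refl = v-free a∈I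
      ... | inj₂ a∈I  | inj₂ b∈I  = independent-elim I I-indep a∈I b∈I

  _∖N[_] : (Fin n → Bool) → Fin n → (Fin n → Bool)
  (W ∖N[ v ]) u = (W ─ v) u ∧ not (adj u v)

  ∖N-intro : ∀ {W v u} → (W ─ v) u ≡ true → adj u v ≡ false → (W ∖N[ v ]) u ≡ true
  ∖N-intro {W} {v} {u} h a rewrite h | a = refl

  ∖N-elim : ∀ {W v u} → (W ∖N[ v ]) u ≡ true → (W ─ v) u ≡ true × adj u v ≡ false
  ∖N-elim {W} {v} {u} h with (W ─ v) u | adj u v
  ... | true | false = refl , refl

  ∖N-⊑ : ∀ W v → (W ∖N[ v ]) ⊑ (W ─ v)
  ∖N-⊑ W v u h = ∧-conicalˡ ((W ─ v) u) _ h

  ∖N-self : ∀ W v → (W ∖N[ v ]) v ≡ false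
  ∖N-self W v = cong (_∧ not (adj v v)) (─-self W v)

-- Elementary facts about the ordered field of reals, and the ring solver
-- (which normalises identities without cancellation; subtractions are
-- handled by the ring lemmas of the library).
module OrderedField (R : RealNumbers) where
  open RealNumbers R public
  open IsDecTotalOrder isDecTotalOrder public using (antisym; total) renaming (trans to ≤-trans)

  commutativeRing : CommutativeRing 0ℓ 0ℓ
  commutativeRing = record { isCommutativeRing = isCommutativeRing }

  open CommutativeRing commutativeRing public
    using (+-identityˡ; +-identityʳ; *-identityˡ; *-identityʳ; +-comm; *-comm; +-assoc; *-assoc;
           zeroʳ; -‿inverseˡ; -‿inverseʳ; distribˡ)
  open import Algebra.Properties.Ring (CommutativeRing.ring commutativeRing) public
    using (-1*x≈-x; -‿involutive; -‿distribˡ-*; -‿distribʳ-*; //-rightDividesˡ; //-rightDividesʳ;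
           ⁻¹-anti-homo‿-; xyx⁻¹≈y; [y-z]x≈yx-zx; x[y-z]≈xy-xz)
  open import Tactic.RingSolver.NonReflective (fromCommutativeRing commutativeRing (λ _ → nothing)) public
    using (solve; _⊜_)
  open import Tactic.RingSolver.Core.Expression public using (_⊕_; _⊗_)

  ≤-refl : ∀ {a} → a ≤ a
  ≤-refl = IsDecTotalOrder.reflexive isDecTotalOrder refl

  0≤-⇒≤ : ∀ {a b} → 0# ≤ b - a → a ≤ b
  0≤-⇒≤ {a} {b} h = subst₂ _≤_ (+-identityˡ a) (//-rightDividesˡ a b) (+-mono-≤ 0# (b - a) a h)

  ≤⇒0≤- : ∀ {a b} → a ≤ b → 0# ≤ b - a
  ≤⇒0≤- {a} {b} h = subst (_≤ b - a) (-‿inverseʳ a) (+-mono-≤ a b (- a) h)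

  ≤0⇒0≤- : ∀ {a} → a ≤ 0# → 0# ≤ - a
  ≤0⇒0≤- {a} h = subst (0# ≤_) (+-identityˡ (- a)) (≤⇒0≤- h)

  0≤-⇒≤0 : ∀ {a} → 0# ≤ - a → a ≤ 0#
  0≤-⇒≤0 {a} h = 0≤-⇒≤ (subst (0# ≤_) (sym (+-identityˡ (- a))) h)

  -- 1 is positive: otherwise 0 ≤ (-1)(-1) = 1 ≤ 0.
  0≤1 : 0# ≤ 1#
  0≤1 with total 0# 1#
  ... | inj₁ 0≤1 = 0≤1
  ... | inj₂ 1≤0 = subst (0# ≤_) (trans (-1*x≈-x (- 1#)) (-‿involutive 1#))
                         (*-nonneg _ _ (≤0⇒0≤- 1≤0) (≤0⇒0≤- 1≤0))

  0≤+ : ∀ {a b} → 0# ≤ a → 0# ≤ b → 0# ≤ a + b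
  0≤+ {a} {b} 0≤a 0≤b = ≤-trans 0≤b (subst (_≤ a + b) (+-identityˡ b) (+-mono-≤ 0# a b 0≤a))

  ≤-+ʳ : ∀ {a b} → 0# ≤ b → a ≤ a + b
  ≤-+ʳ {a} {b} 0≤b = subst₂ _≤_ (+-identityˡ a) (+-comm b a) (+-mono-≤ 0# b a 0≤b)

  <-≤-pos : ∀ {a b} → 0# < a → a ≤ b → 0# < b
  <-≤-pos {a} (0≤a , 0≢a) a≤b =
    ≤-trans 0≤a a≤b , λ 0≡b → 0≢a (antisym 0≤a (subst (a ≤_) (sym 0≡b) a≤b))

  opposite-cancel : ∀ {s t} w → s ≡ - t → s * w + t * w ≡ 0#
  opposite-cancel {s} {t} w s≡-t =
    trans (cong (_+ t * w) (trans (cong (_* w) s≡-t) (sym (-‿distribˡ-* t w)))) (-‿inverseˡ (t * w))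

  a-[a-t] : ∀ a t → a - (a - t) ≡ t
  a-[a-t] a t = trans (cong (a +_) (⁻¹-anti-homo‿- a t)) (trans (sym (+-assoc a t (- a))) (xyx⁻¹≈y a t))

  1-quotient : ∀ A B q y → B ≡ A - q → A * y ≡ 1# → 1# - B * y ≡ q * y
  1-quotient A B q y B≡A-q Ay≡1 =
    trans (cong (λ b → 1# - b * y) B≡A-q)
          (trans (cong (λ b → 1# - b) (trans ([y-z]x≈yx-zx y A q) (cong (_- q * y) Ay≡1))) (a-[a-t] 1# (q * y)))

  factor-1- : ∀ a b → a - b * a ≡ a * (1# - b)
  factor-1- a b = trans (cong₂ _-_ (sym (*-identityʳ a)) (*-comm b a)) (sym (x[y-z]≈xy-xz a 1# b))

  inverse-nonneg : ∀ {a y} → 0# < a → a * y ≡ 1# → 0# ≤ y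
  inverse-nonneg {a} {y} (0≤a , _) ay≡1 with total 0# y
  ... | inj₁ 0≤y = 0≤y
  ... | inj₂ y≤0 = ⊥-elim (0≢1 (antisym 0≤1 (0≤-⇒≤0 0≤-1)))
    where
    0≤-1 : 0# ≤ - 1#
    0≤-1 = subst (0# ≤_) (trans (sym (-‿distribʳ-* a y)) (cong -_ ay≡1)) (*-nonneg a (- y) 0≤a (≤0⇒0≤- y≤0))

foldr-allFin-suc : ∀ {B : Set} {n} (g : Fin (suc n) → B → B) e →
                   foldr g e (allFin (suc n)) ≡ g zero (foldr (g ∘ suc) e (allFin n))
foldr-allFin-suc {n = n} g e =
  cong (g zero) (trans (cong (foldr g e) (sym (List.map-tabulate (λ i → i) suc)))
                       (List.foldr-map g suc e (allFin n)))

module BigOperators (R : RealNumbers) where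
  open OrderedField R
  open Sums R using (prodWhere)

  sumL : {X : Set} → (X → Carrier) → List X → Carrier
  sumL f = foldr (λ x acc → f x + acc) 0#

  Σˢ : ∀ {n} → (Subset n → Carrier) → Carrier
  Σˢ {n} f = sumL f (allSubsets n)

  module _ {X : Set} where

    sumL-++ : ∀ (f : X → Carrier) xs ys → sumL f (xs ++ ys) ≡ sumL f xs + sumL f ys
    sumL-++ f []       ys = sym (+-identityˡ _)
    sumL-++ f (x ∷ xs) ys = trans (cong (f x +_) (sumL-++ f xs ys)) (sym (+-assoc _ _ _))

    sumL-cong : ∀ {f g : X → Carrier} → (∀ x → f x ≡ g x) → ∀ xs → sumL f xs ≡ sumL g xs
    sumL-cong h []       = refl
    sumL-cong h (x ∷ xs) = cong₂ _+_ (h x) (sumL-cong h xs)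

    sumL-+ : ∀ (f g : X → Carrier) xs → sumL (λ x → f x + g x) xs ≡ sumL f xs + sumL g xs
    sumL-+ f g []       = sym (+-identityˡ 0#)
    sumL-+ f g (x ∷ xs) = trans (cong (f x + g x +_) (sumL-+ f g xs))
                                (solve 4 (λ a b c d → ((a ⊕ b) ⊕ (c ⊕ d)) ⊜ ((a ⊕ c) ⊕ (b ⊕ d))) refl _ _ _ _)

    sumL-* : ∀ c (f : X → Carrier) xs → sumL (λ x → c * f x) xs ≡ c * sumL f xs
    sumL-* c f []       = sym (zeroʳ c)
    sumL-* c f (x ∷ xs) = trans (cong (c * f x +_) (sumL-* c f xs)) (sym (distribˡ c (f x) _))

    sumL-0 : ∀ (xs : List X) → sumL (λ _ → 0#) xs ≡ 0#
    sumL-0 []       = refl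
    sumL-0 (x ∷ xs) = trans (cong (0# +_) (sumL-0 xs)) (+-identityˡ 0#)

  module _ {n : ℕ} where

    Σˢ-cong : ∀ {f g : Subset n → Carrier} → (∀ I → f I ≡ g I) → Σˢ f ≡ Σˢ g
    Σˢ-cong h = sumL-cong h (allSubsets n)

    Σˢ-+ : ∀ (f g : Subset n → Carrier) → Σˢ (λ I → f I + g I) ≡ Σˢ f + Σˢ g
    Σˢ-+ f g = sumL-+ f g (allSubsets n)

    Σˢ-* : ∀ c (f : Subset n → Carrier) → Σˢ (λ I → c * f I) ≡ c * Σˢ f
    Σˢ-* c f = sumL-* c f (allSubsets n)

    Σˢ-0 : Σˢ {n} (λ _ → 0#) ≡ 0#
    Σˢ-0 = sumL-0 (allSubsets n)

    Σˢ-suc : ∀ (f : Subset (suc n) → Carrier) → Σˢ f ≡ Σˢ (λ I → f (true ∷ I)) + Σˢ (λ I → f (false ∷ I))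
    Σˢ-suc f = trans (sumL-++ f (map (true ∷_) (allSubsets n)) _)
                     (cong₂ _+_ (List.foldr-map _ (true ∷_) 0# (allSubsets n))
                                (List.foldr-map _ (false ∷_) 0# (allSubsets n)))

  Σˢ-at-⊥ : ∀ {n} (f : Subset n → Carrier) → (∀ I v → lookup I v ≡ true → f I ≡ 0#) → Σˢ f ≡ f ⊥
  Σˢ-at-⊥ {zero}  f h = +-identityʳ _
  Σˢ-at-⊥ {suc n} f h =
    trans (Σˢ-suc f)
      (trans (cong₂ _+_ (trans (Σˢ-cong (λ I → h (true ∷ I) zero refl)) (Σˢ-0 {n}))
                        (Σˢ-at-⊥ (λ I → f (false ∷ I)) (λ I v → h (false ∷ I) (suc v))))
             (+-identityˡ _))

  -- Pairing each I ∌ v with I + v: the subsets containing v are exactly the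
  -- sets I + v with I ∌ v.  This is how v is singled out in all identities
  -- for σ below.
  pairedAt : ∀ {n} → Fin n → (Subset n → Carrier) → Subset n → Carrier
  pairedAt v f I = if lookup I v then 0# else f I + f (ins v I)

  Σˢ-pairs : ∀ {n} (v : Fin n) (f : Subset n → Carrier) → Σˢ f ≡ Σˢ (pairedAt v f)
  Σˢ-pairs {suc n} zero f =
    begin
      Σˢ f
    ≡⟨ Σˢ-suc f ⟩
      Σˢ (λ I → f (true ∷ I)) + Σˢ (λ I → f (false ∷ I))
    ≡⟨ trans (+-comm _ _) (sym (Σˢ-+ (λ I → f (false ∷ I)) (λ I → f (true ∷ I)))) ⟩
      Σˢ (λ I → f (false ∷ I) + f (true ∷ I))
    ≡⟨ sym (trans (cong (_+ Σˢ (λ I → f (false ∷ I) + f (true ∷ I))) (Σˢ-0 {n})) (+-identityˡ _)) ⟩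
      Σˢ {n} (λ _ → 0#) + Σˢ (λ I → f (false ∷ I) + f (true ∷ I))
    ≡⟨ sym (Σˢ-suc (pairedAt zero f)) ⟩
      Σˢ (pairedAt zero f)
    ∎
    where open ≡-Reasoning
  Σˢ-pairs {suc n} (suc v) f =
    trans (Σˢ-suc f)
      (trans (cong₂ _+_ (Σˢ-pairs v (λ I → f (true ∷ I))) (Σˢ-pairs v (λ I → f (false ∷ I))))
             (sym (Σˢ-suc (pairedAt (suc v) f))))

  prodL : ∀ {n} → (Fin n → Bool) → (Fin n → Carrier) → List (Fin n) → Carrier
  prodL c f = foldr (λ v acc → if c v then f v * acc else acc) 1#

  module _ {n : ℕ} where

    prodWhere-empty : ∀ (c : Fin n → Bool) f → (∀ u → c u ≡ false) → prodWhere c f ≡ 1#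
    prodWhere-empty c f h = go (allFin n)
      where
      go : ∀ xs → prodL c f xs ≡ 1#
      go []       = refl
      go (x ∷ xs) rewrite h x = go xs

    prodWhere-⊔ : ∀ (c c₁ c₂ : Fin n → Bool) f →
                  (∀ u → c u ≡ c₁ u ∨ c₂ u) → (∀ u → c₁ u ∧ c₂ u ≡ false) →
                  prodWhere c f ≡ prodWhere c₁ f * prodWhere c₂ f
    prodWhere-⊔ c c₁ c₂ f split disjoint = go (allFin n)
      where
      go : ∀ xs → prodL c f xs ≡ prodL c₁ f xs * prodL c₂ f xs
      go []       = sym (*-identityˡ 1#)
      go (x ∷ xs) rewrite split x | go xs with c₁ x | c₂ x | disjoint x
      ... | true  | false | _ = sym (*-assoc _ _ _)
      ... | false | true  | _ = solve 3 (λ a b c → (a ⊗ (b ⊗ c)) ⊜ (b ⊗ (a ⊗ c))) refl _ _ _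
      ... | false | false | _ = refl

  prodWhere-single : ∀ {n} (r : Fin n) f → prodWhere (_≡ᵇ r) f ≡ f r
  prodWhere-single {suc n} zero f =
    trans (foldr-allFin-suc (λ v acc → if v ≡ᵇ zero then f v * acc else acc) 1#)
          (trans (cong (f zero *_) (prodWhere-empty {n} (λ u → suc u ≡ᵇ zero) (f ∘ suc) (λ _ → refl)))
                 (*-identityʳ _))
  prodWhere-single {suc n} (suc r) f =
    trans (foldr-allFin-suc (λ v acc → if v ≡ᵇ suc r then f v * acc else acc) 1#) (prodWhere-single r (f ∘ suc))

module AlternatingSums (R : RealNumbers) {n : ℕ} (G : Graph n) (p : Fin n → RealNumbers.Carrier R) where
  open OrderedField R
  open Sums R using (sign; prodWhere; σ)
  open BigOperators R
  open Independence G

  everything : Fin n → Bool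
  everything _ = true

  weight : Subset n → Carrier
  weight I = prodWhere (lookup I) p

  admissible : (Fin n → Bool) → Subset n → Subset n → Bool
  admissible W S I = ((S ⊆ᵇ I) ∧ independentᵇ G I) ∧ I ⊆ᵖ W

  term : (Fin n → Bool) → Subset n → Subset n → Carrier
  term W S I = if admissible W S I then sign (∣ I ∣ ∸ ∣ S ∣) * weight I else 0#

  σ[_] : (Fin n → Bool) → Subset n → Carrier
  σ[ W ] S = Σˢ (term W S)

  -- The independence polynomial of G[W] at -p.
  Z : (Fin n → Bool) → Carrier
  Z W = σ[ W ] ⊥

  admissible-⊇ : ∀ W S I → admissible W S I ≡ true → S ⊆ᵇ I ≡ true
  admissible-⊇ W S I h = ∧-conicalˡ (S ⊆ᵇ I) (independentᵇ G I) (∧-conicalˡ _ (I ⊆ᵖ W) h)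

  admissible-⊆ : ∀ W S I → admissible W S I ≡ true → I ⊆ᵖ W ≡ true
  admissible-⊆ W S I h = ∧-conicalʳ ((S ⊆ᵇ I) ∧ independentᵇ G I) (I ⊆ᵖ W) h

  term-0 : ∀ W S I → admissible W S I ≡ false → term W S I ≡ 0#
  term-0 W S I h rewrite h = refl

  σ-everything : ∀ S → σ G p S ≡ σ[ everything ] S
  σ-everything S = go (allSubsets n)
    where
    go : ∀ Is → foldr (λ I acc → if (S ⊆ᵇ I) ∧ independentᵇ G I
                                   then sign (∣ I ∣ ∸ ∣ S ∣) * weight I + acc else acc) 0# Is
              ≡ sumL (term everything S) Is
    go []       = refl
    go (I ∷ Is) rewrite ⊆ᵖ-intro {I = I} {W = everything} (λ _ _ → refl)
                      | ∧-identityʳ ((S ⊆ᵇ I) ∧ independentᵇ G I) | go Is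
                with (S ⊆ᵇ I) ∧ independentᵇ G I
    ... | true  = refl
    ... | false = sym (+-identityˡ _)

  term-cong : ∀ W W' S I → admissible W S I ≡ admissible W' S I → term W S I ≡ term W' S I
  term-cong W W' S I h = cong (λ b → if b then sign (∣ I ∣ ∸ ∣ S ∣) * weight I else 0#) h

  σ-cong : ∀ {W W'} → (∀ u → W u ≡ W' u) → ∀ S → σ[ W ] S ≡ σ[ W' ] S
  σ-cong {W} {W'} h S =
    Σˢ-cong λ I → term-cong W W' S I (cong (((S ⊆ᵇ I) ∧ independentᵇ G I) ∧_) (⊆ᵖ-cong {I = I} (λ u _ → h u)))

  σ-vanish : ∀ W v S → W v ≡ false → lookup S v ≡ true → σ[ W ] S ≡ 0#
  σ-vanish W v S v∉W v∈S = trans (Σˢ-cong (λ I → term-0 W S I (¬-not (inadmissible I)))) (Σˢ-0 {n})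
    where
    inadmissible : ∀ I → admissible W S I ≢ true
    inadmissible I h =
      true≢false (trans (sym (⊆ᵖ-elim {I = I} {W = W} (admissible-⊆ W S I h)
                               (⊆ᵖ-elim {I = S} {W = lookup I} (admissible-⊇ W S I h) v∈S)))
                        v∉W)

  admissible-─ : ∀ W v S I → lookup I v ≡ false → admissible (W ─ v) S I ≡ admissible W S I
  admissible-─ W v S I v∉I =
    cong (((S ⊆ᵇ I) ∧ independentᵇ G I) ∧_) (⊆ᵖ-cong {I = I} (λ u u∈I → ─-other W (separated (lookup I) u∈I v∉I)))

  admissible-ins-∉W : ∀ W v S I → W v ≡ false → admissible W S (ins v I) ≡ false
  admissible-ins-∉W W v S I v∉W =
    trans (cong (((S ⊆ᵇ ins v I) ∧ independentᵇ G (ins v I)) ∧_) (trans (ins-⊆ᵖ v I W) (cong (_∧ I ⊆ᵖ W) v∉W)))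
          (∧-zeroʳ _)

  admissible-ins-∉I : ∀ W v S I → lookup I v ≡ false → admissible W (ins v S) I ≡ false
  admissible-ins-∉I W v S I v∉I =
    cong (λ b → (b ∧ independentᵇ G I) ∧ I ⊆ᵖ W) (trans (ins-⊆ᵖ v S (lookup I)) (cong (_∧ S ⊆ᵇ I) v∉I))

  admissible-ins-both : ∀ W v S I → admissible W (ins v S) (ins v I) ≡ admissible W S (ins v I)
  admissible-ins-both W v S I =
    cong (λ b → (b ∧ independentᵇ G (ins v I)) ∧ ins v I ⊆ᵖ W)
         (trans (ins-⊆ᵖ v S (lookup (ins v I))) (cong (_∧ S ⊆ᵇ ins v I) (lookup-ins-self v I)))

  sign-flip : ∀ v (S I : Subset n) → lookup S v ≡ false → lookup I v ≡ false → S ⊆ᵇ I ≡ true →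
              sign (∣ ins v I ∣ ∸ ∣ S ∣) ≡ - sign (∣ ins v I ∣ ∸ ∣ ins v S ∣)
  sign-flip v S I v∉S v∉I S⊆I rewrite ∣ins∣ v I v∉I | ∣ins∣ v S v∉S =
    cong sign (ℕₚ.+-∸-assoc 1 (∣∣-mono {S = S} {I = I} S⊆I))

  pair-cancels : ∀ W v S I → lookup S v ≡ false → lookup I v ≡ false →
                 term W S (ins v I) + term W (ins v S) (ins v I) ≡ 0#
  pair-cancels W v S I v∉S v∉I =
    trans (cong (λ c → term W S I⁺ + (if c then sign (∣ I⁺ ∣ ∸ ∣ ins v S ∣) * weight I⁺ else 0#))
                (admissible-ins-both W v S I))
          (if-cancel (admissible W S I⁺) λ adm →
             opposite-cancel (weight I⁺)
               (sign-flip v S I v∉S v∉I (trans (sym (⊆ᵇ-ins v S I v∉S)) (admissible-⊇ W S I⁺ adm))))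
    where
    I⁺ = ins v I
    if-cancel : ∀ c {a b} → (c ≡ true → a + b ≡ 0#) → (if c then a else 0#) + (if c then b else 0#) ≡ 0#
    if-cancel true  h = h refl
    if-cancel false h = +-identityˡ 0#

  σ-hereditary : ∀ W v S → lookup S v ≡ false → σ[ W ─ v ] S ≡ σ[ W ] S + σ[ W ] (ins v S)
  σ-hereditary W v S v∉S =
    begin
      σ[ W ─ v ] S
    ≡⟨ Σˢ-pairs v (term (W ─ v) S) ⟩
      Σˢ (pairedAt v (term (W ─ v) S))
    ≡⟨ Σˢ-cong pointwise ⟩
      Σˢ (λ I → pairedAt v (term W S) I + pairedAt v (term W (ins v S)) I)
    ≡⟨ Σˢ-+ (pairedAt v (term W S)) (pairedAt v (term W (ins v S))) ⟩
      Σˢ (pairedAt v (term W S)) + Σˢ (pairedAt v (term W (ins v S)))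
    ≡⟨ sym (cong₂ _+_ (Σˢ-pairs v (term W S)) (Σˢ-pairs v (term W (ins v S)))) ⟩
      σ[ W ] S + σ[ W ] (ins v S)
    ∎
    where
    open ≡-Reasoning
    pointwise : ∀ I → pairedAt v (term (W ─ v) S) I
                      ≡ pairedAt v (term W S) I + pairedAt v (term W (ins v S)) I
    pointwise I with lookup I v in I[v]
    ... | true  = sym (+-identityˡ 0#)
    ... | false =
      begin
        term (W ─ v) S I + term (W ─ v) S (ins v I)
      ≡⟨ cong₂ _+_ (term-cong (W ─ v) W S I (admissible-─ W v S I I[v]))
                   (term-0 (W ─ v) S (ins v I) (admissible-ins-∉W (W ─ v) v S I (─-self W v))) ⟩
        a + 0#
      ≡⟨ cong (a +_) (sym (pair-cancels W v S I v∉S I[v])) ⟩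
        a + (b + c)
      ≡⟨ sym (+-assoc a b c) ⟩
        (a + b) + c
      ≡⟨ cong ((a + b) +_) (sym (trans (cong (_+ c) (term-0 W (ins v S) I (admissible-ins-∉I W v S I I[v])))
                                        (+-identityˡ c))) ⟩
        (a + b) + (term W (ins v S) I + c)
      ∎
      where
      a = term W S I
      b = term W S (ins v I)
      c = term W (ins v S) (ins v I)

  weight-ins : ∀ v I → lookup I v ≡ false → weight (ins v I) ≡ p v * weight I
  weight-ins v I v∉I =
    trans (prodWhere-⊔ (lookup (ins v I)) (_≡ᵇ v) (lookup I) p (λ u → lookup-ins v u I) disjoint)
          (cong (_* weight I) (prodWhere-single v p))
    where
    disjoint : ∀ u → (u ≡ᵇ v) ∧ lookup I u ≡ false
    disjoint u with u ≟ v
    ... | yes refl = v∉I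
    ... | no _     = refl

  admissible-single : ∀ W v I → W v ≡ true → lookup I v ≡ false →
                      admissible W (ins v ⊥) (ins v I) ≡ admissible (W ∖N[ v ]) ⊥ I
  admissible-single W v I v∈W v∉I =
    begin
      ((ins v ⊥ ⊆ᵇ ins v I) ∧ independentᵇ G (ins v I)) ∧ ins v I ⊆ᵖ W
    ≡⟨ cong₂ (λ a b → (a ∧ independentᵇ G (ins v I)) ∧ b) single⊆
             (trans (ins-⊆ᵖ v I W) (cong (_∧ I ⊆ᵖ W) v∈W)) ⟩
      independentᵇ G (ins v I) ∧ I ⊆ᵖ W
    ≡⟨ cong (_∧ I ⊆ᵖ W) (independent-ins v I) ⟩
      (independentᵇ G I ∧ I ⊆ᵖ nonNeighbours v) ∧ I ⊆ᵖ W
    ≡⟨ trans (∧-assoc (independentᵇ G I) _ (I ⊆ᵖ W))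
             (cong (independentᵇ G I ∧_) (∧-comm (I ⊆ᵖ nonNeighbours v) (I ⊆ᵖ W))) ⟩
      independentᵇ G I ∧ (I ⊆ᵖ W ∧ I ⊆ᵖ nonNeighbours v)
    ≡⟨ cong (λ b → independentᵇ G I ∧ (b ∧ I ⊆ᵖ nonNeighbours v))
            (sym (⊆ᵖ-cong {I = I} (λ u u∈I → ─-other W (separated (lookup I) u∈I v∉I)))) ⟩
      independentᵇ G I ∧ (I ⊆ᵖ (W ─ v) ∧ I ⊆ᵖ nonNeighbours v)
    ≡⟨ cong₂ (λ a b → (a ∧ independentᵇ G I) ∧ b)
             (sym (⊥⊆ᵖ (lookup I))) (sym (⊆ᵖ-∧ I (W ─ v) (nonNeighbours v))) ⟩
      ((⊥ ⊆ᵇ I) ∧ independentᵇ G I) ∧ I ⊆ᵖ (W ∖N[ v ])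
    ∎
    where
    open ≡-Reasoning
    single⊆ : ins v ⊥ ⊆ᵇ ins v I ≡ true
    single⊆ = trans (ins-⊆ᵖ v ⊥ (lookup (ins v I))) (cong₂ _∧_ (lookup-ins-self v I) (⊥⊆ᵖ (lookup (ins v I))))

  term-single : ∀ W v I → W v ≡ true → lookup I v ≡ false →
                term W (ins v ⊥) (ins v I) ≡ p v * term (W ∖N[ v ]) ⊥ I
  term-single W v I v∈W v∉I =
    trans (cong (λ c → if c then sign (∣ ins v I ∣ ∸ ∣ ins v ⊥ ∣) * weight (ins v I) else 0#)
                (admissible-single W v I v∈W v∉I))
          (scale (admissible (W ∖N[ v ]) ⊥ I) value)
    where
    value : sign (∣ ins v I ∣ ∸ ∣ ins v ⊥ ∣) * weight (ins v I) ≡ p v * (sign (∣ I ∣ ∸ ∣ ⊥ {n} ∣) * weight I)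
    value rewrite ∣ins∣ v I v∉I | ∣ins∣ v ⊥ (lookup-⊥ v) | weight-ins v I v∉I =
      solve 3 (λ s a b → (s ⊗ (a ⊗ b)) ⊜ (a ⊗ (s ⊗ b))) refl _ _ _
    scale : ∀ c {a b} → a ≡ p v * b → (if c then a else 0#) ≡ p v * (if c then b else 0#)
    scale true  a≡pb = a≡pb
    scale false _    = sym (zeroʳ (p v))

  σ-single : ∀ W v → W v ≡ true → σ[ W ] (ins v ⊥) ≡ p v * Z (W ∖N[ v ])
  σ-single W v v∈W =
    begin
      σ[ W ] (ins v ⊥)
    ≡⟨ Σˢ-pairs v (term W (ins v ⊥)) ⟩
      Σˢ (pairedAt v (term W (ins v ⊥)))
    ≡⟨ Σˢ-cong pointwise ⟩
      Σˢ (λ I → p v * pairedAt v (term (W ∖N[ v ]) ⊥) I)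
    ≡⟨ Σˢ-* (p v) (pairedAt v (term (W ∖N[ v ]) ⊥)) ⟩
      p v * Σˢ (pairedAt v (term (W ∖N[ v ]) ⊥))
    ≡⟨ cong (p v *_) (sym (Σˢ-pairs v (term (W ∖N[ v ]) ⊥))) ⟩
      p v * Z (W ∖N[ v ])
    ∎
    where
    open ≡-Reasoning
    pointwise : ∀ I → pairedAt v (term W (ins v ⊥)) I ≡ p v * pairedAt v (term (W ∖N[ v ]) ⊥) I
    pointwise I with lookup I v in I[v]
    ... | true  = sym (zeroʳ (p v))
    ... | false =
      begin
        term W (ins v ⊥) I + term W (ins v ⊥) (ins v I)
      ≡⟨ cong₂ _+_ (term-0 W (ins v ⊥) I (admissible-ins-∉I W v ⊥ I I[v])) (term-single W v I v∈W I[v]) ⟩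
        0# + p v * term (W ∖N[ v ]) ⊥ I
      ≡⟨ trans (+-identityˡ _) (cong (p v *_) (sym (+-identityʳ _))) ⟩
        p v * (term (W ∖N[ v ]) ⊥ I + 0#)
      ≡⟨ cong (λ t → p v * (term (W ∖N[ v ]) ⊥ I + t))
              (sym (term-0 (W ∖N[ v ]) ⊥ (ins v I) (admissible-ins-∉W (W ∖N[ v ]) v ⊥ I (∖N-self W v)))) ⟩
        p v * (term (W ∖N[ v ]) ⊥ I + term (W ∖N[ v ]) ⊥ (ins v I))
      ∎

  deletion : ∀ W v → W v ≡ true → Z W ≡ Z (W ─ v) - p v * Z (W ∖N[ v ])
  deletion W v v∈W =
    sym (trans (cong (_- p v * Z (W ∖N[ v ])) (trans (σ-hereditary W v ⊥ (lookup-⊥ v)) (cong (Z W +_) (σ-single W v v∈W))))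
               (//-rightDividesʳ (p v * Z (W ∖N[ v ])) (Z W)))

  Z-empty : ∀ W → (∀ u → W u ≡ false) → Z W ≡ 1#
  Z-empty W none =
    trans (Σˢ-at-⊥ (term W ⊥) outside)
          (trans (cong (λ c → if c then sign (∣ ⊥ {n} ∣ ∸ ∣ ⊥ {n} ∣) * weight ⊥ else 0#) ⊥-admissible) value)
    where
    outside : ∀ I v → lookup I v ≡ true → term W ⊥ I ≡ 0#
    outside I v v∈I = term-0 W ⊥ I (¬-not λ h →
      true≢false (trans (sym (⊆ᵖ-elim {I = I} {W = W} (admissible-⊆ W ⊥ I h) v∈I)) (none v)))
    ⊥-admissible : admissible W ⊥ ⊥ ≡ true
    ⊥-admissible =
      cong₂ _∧_ (cong₂ _∧_ (⊥⊆ᵖ {n} (lookup ⊥))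
                           (independent-intro ⊥ λ a _ a∈⊥ _ → ⊥-elim (true≢false (trans (sym a∈⊥) (lookup-⊥ a)))))
                (⊥⊆ᵖ W)
    value : sign (∣ ⊥ {n} ∣ ∸ ∣ ⊥ {n} ∣) * weight ⊥ ≡ 1#
    value rewrite ℕₚ.n∸n≡0 ∣ ⊥ {n} ∣ = trans (*-identityˡ _) (prodWhere-empty (lookup ⊥) p lookup-⊥)

module Positivity (R : RealNumbers) {n : ℕ} (G : Graph n) (p : Fin n → RealNumbers.Carrier R) where
  open OrderedField R
  open AlternatingSums R G p

  missing-vertex : ∀ (W : Fin n → Bool) → (∃ λ v → W v ≡ false) ⊎ (∀ u → W u ≡ true)
  missing-vertex W with any? (λ v → W v Bool.≟ false)
  ... | yes found = inj₁ found
  ... | no none   = inj₂ (λ u → ¬-not (λ Wu≡false → none (u , Wu≡false)))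

  Positive : (Fin n → Bool) → Set
  Positive W = (∀ S → 0# ≤ σ[ W ] S) × (Z everything ≤ Z W)

  addVertex : (Fin n → Bool) → Fin n → (Fin n → Bool)
  addVertex W v u = W u ∨ (u ≡ᵇ v)

  addVertex-─ : ∀ W v → W v ≡ false → ∀ u → (addVertex W v ─ v) u ≡ W u
  addVertex-─ W v v∉W u with u ≟ v
  ... | yes refl = trans (∧-zeroʳ _) (sym v∉W)
  ... | no _     = trans (∧-identityʳ _) (∨-identityʳ (W u))

  addVertex-smaller : ∀ W v → W v ≡ false → size (not ∘ addVertex W v) <ℕ size (not ∘ W)
  addVertex-smaller W v v∉W = size-< {D = not ∘ W} {D' = not ∘ addVertex W v} {r = v} shrinks (cong not v∉W) v-added
    where
    shrinks : (not ∘ addVertex W v) ⊑ (not ∘ W)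
    shrinks u h with W u
    ... | false = refl
    ... | true  = h
    v-added : not (addVertex W v v) ≡ false
    v-added = cong not (trans (cong (W v ∨_) (≡ᵇ-refl v)) (∨-zeroʳ (W v)))

  -- For v ∉ W, positivity of W ∪ {v} implies that of W: the hereditary
  -- recursion writes σ_W(S) = σ_{(W∪v)-v}(S) as σ_{W∪v}(S) + σ_{W∪v}(S+v)
  -- when v ∉ S, and σ_W(S) = 0 when v ∈ S.
  positive-remove : ∀ W v → W v ≡ false → Positive (addVertex W v) → Positive W
  positive-remove W v v∉W (σ'≥0 , Z≤Z') = σ≥0 , ≤-trans Z≤Z' Z'≤Z
    where
    hereditary : ∀ S → lookup S v ≡ false → σ[ W ] S ≡ σ[ addVertex W v ] S + σ[ addVertex W v ] (ins v S)
    hereditary S v∉S = trans (sym (σ-cong (addVertex-─ W v v∉W) S)) (σ-hereditary (addVertex W v) v S v∉S)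
    σ≥0 : ∀ S → 0# ≤ σ[ W ] S
    σ≥0 S with lookup S v in S[v]
    ... | true  = subst (0# ≤_) (sym (σ-vanish W v S v∉W S[v])) ≤-refl
    ... | false = subst (0# ≤_) (sym (hereditary S S[v])) (0≤+ (σ'≥0 S) (σ'≥0 (ins v S)))
    Z'≤Z : Z (addVertex W v) ≤ Z W
    Z'≤Z = subst (Z (addVertex W v) ≤_) (sym (hereditary ⊥ (lookup-⊥ v))) (≤-+ʳ (σ'≥0 (ins v ⊥)))

  positivity : (∀ S → 0# ≤ σ[ everything ] S) → ∀ W → Positive W
  positivity σ≥0 W = go (suc (size (not ∘ W))) W (ℕₚ.n<1+n _)
    where
    go : ∀ bound W → size (not ∘ W) <ℕ bound → Positive W
    go (suc bound) W small with missing-vertex W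
    ... | inj₂ all = (λ S → subst (0# ≤_) (σ-cong V≗W S) (σ≥0 S)) , subst (Z everything ≤_) (σ-cong V≗W ⊥) ≤-refl
      where
      V≗W : ∀ u → everything u ≡ W u
      V≗W u = sym (all u)
    ... | inj₁ (v , v∉W) =
      positive-remove W v v∉W (go bound (addVertex W v) (ℕₚ.<-≤-trans (addVertex-smaller W v v∉W) (ℕₚ.≤-pred small)))

module TreeStructure {n : ℕ} (G : Graph n) (T : TreeOrder n) (LH : Lefthanded G T) where
  open TreeOrder T using (le; tree) renaming (refl to ≤ᵗ-refl; trans to ≤ᵗ-trans; antisym to ≤ᵗ-antisym)
  open Graph G using (adj; adj-sym; adj-irrefl)
  open Lefthanded LH using (adj-comparable; left)
  open Independence G

  ↓_ : Fin n → (Fin n → Bool)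
  (↓ v) u = le u v

  DownClosed : (Fin n → Bool) → Set
  DownClosed D = ∀ u w → D u ≡ true → le w u ≡ true → D w ≡ true

  Maximal : (Fin n → Bool) → Fin n → Set
  Maximal D r = D r ≡ true × (∀ u → D u ≡ true → le r u ≡ true → u ≡ r)

  ↓-closed : ∀ v → DownClosed (↓ v)
  ↓-closed v u w u≤v w≤u = ≤ᵗ-trans w u v w≤u u≤v

  ↓-maximal : ∀ v → Maximal (↓ v) v
  ↓-maximal v = ≤ᵗ-refl v , λ u u≤v v≤u → ≤ᵗ-antisym u v u≤v v≤u

  above : (Fin n → Bool) → Fin n → (Fin n → Bool)
  above D d = (λ u → D u ∧ le d u) ─ d

  above-intro : ∀ {D d u} → D u ≡ true → le d u ≡ true → u ≢ d → above D d u ≡ true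
  above-intro {D} {d} u∈D d≤u u≢d = ─-intro {W = λ u → D u ∧ le d u} (cong₂ _∧_ u∈D d≤u) u≢d

  above-elim : ∀ {D d u} → above D d u ≡ true → D u ≡ true × le d u ≡ true × u ≢ d
  above-elim {D} {d} {u} h with ─-elim {W = λ u → D u ∧ le d u} h
  ... | D∧≥ , u≢d = ∧-conicalˡ (D u) _ D∧≥ , ∧-conicalʳ (D u) _ D∧≥ , u≢d

  -- Every nonempty D has a maximal element: climbing strictly upwards shrinks
  -- the set of elements above the current one.
  maximal-exists : ∀ D d → D d ≡ true → ∃ (Maximal D)
  maximal-exists D d d∈D = climb (suc (size (above D d))) d d∈D (ℕₚ.n<1+n _)
    where
    climb : ∀ bound d → D d ≡ true → size (above D d) <ℕ bound → ∃ (Maximal D)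
    climb (suc bound) d d∈D small with any? (λ u → above D d u Bool.≟ true)
    ... | no nothing-above = d , d∈D , top
      where
      top : ∀ u → D u ≡ true → le d u ≡ true → u ≡ d
      top u u∈D d≤u with u ≟ d
      ... | yes u≡d = u≡d
      ... | no u≢d  = ⊥-elim (nothing-above (u , above-intro {D} u∈D d≤u u≢d))
    ... | yes (u , u-above) with above-elim {D} u-above
    ...   | u∈D , d≤u , u≢d =
      climb bound u u∈D (ℕₚ.<-≤-trans (size-< higher u-above (─-self (λ w → D w ∧ le u w) u)) (ℕₚ.≤-pred small))
      where
      higher : above D u ⊑ above D d
      higher w w-above with above-elim {D} w-above
      ... | w∈D , u≤w , w≢u = above-intro {D} w∈D (≤ᵗ-trans d u w d≤u u≤w) w≢d
        where
        w≢d : w ≢ d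
        w≢d refl = w≢u (≤ᵗ-antisym w u d≤u u≤w)

  ─-closed : ∀ D r → DownClosed D → Maximal D r → DownClosed (D ─ r)
  ─-closed D r closed (_ , r-top) u w u∈ w≤u with ─-elim {W = D} u∈
  ... | u∈D , u≢r = ─-intro {W = D} (closed u w u∈D w≤u) w≢r
    where
    w≢r : w ≢ r
    w≢r refl = u≢r (r-top u u∈D w≤u)

  -- The use of lefthandedness: if r is maximal in a down-closed D and u ∈ D
  -- is not a neighbour of r, then neither is any w ≤ u.  Otherwise w ≤ r by
  -- comparability, so w < u < r by the tree property and maximality, and
  -- r ∼ w forces r ∼ u.
  below-nonneighbour : ∀ D r → Maximal D r → ∀ {u w} → D u ≡ true → u ≢ r → adj u r ≡ false →
                       le w u ≡ true → w ≢ r → adj w r ≢ true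
  below-nonneighbour D r (_ , r-top) {u} {w} u∈D u≢r u≁r w≤u w≢r w∼r with adj-comparable w r w∼r
  ... | inj₂ r≤w = u≢r (r-top u u∈D (≤ᵗ-trans r w u r≤w w≤u))
  ... | inj₁ w≤r with tree w u r (w≤u , separated (λ x → adj x r) w∼r u≁r) (w≤r , w≢r)
  ...   | inj₂ r≤u = u≢r (r-top u u∈D r≤u)
  ...   | inj₁ u≤r = true≢false (trans (sym r∼u) (trans (adj-sym r u) u≁r))
    where
    r∼u : adj r u ≡ true
    r∼u = left w u r (w≤u , separated (λ x → adj x r) w∼r u≁r) (u≤r , u≢r) (trans (adj-sym r w) w∼r)

  ∖N-closed : ∀ D r → DownClosed D → Maximal D r → DownClosed (D ∖N[ r ])
  ∖N-closed D r closed r-max@(_ , r-top) u w u∈ w≤u with ∖N-elim {D} u∈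
  ... | u∈D─r , u≁r with ─-elim {W = D} u∈D─r
  ...   | u∈D , u≢r = ∖N-intro {D} (─-intro {W = D} (closed u w u∈D w≤u) w≢r)
                                  (¬-not (below-nonneighbour D r r-max u∈D u≢r u≁r w≤u w≢r))
    where
    w≢r : w ≢ r
    w≢r refl = u≢r (r-top u u∈D w≤u)

  lowerNeighbours : Fin n → (Fin n → Bool)
  lowerNeighbours v u = adj u v ∧ le u v

  -- For r maximal in a down-closed D, the neighbours of r in D are exactly its
  -- lower neighbours, so D - r is the disjoint union of D ∖ N[r] and them.
  neighbourhood-split : ∀ D r → DownClosed D → Maximal D r →
                        ∀ u → (D ─ r) u ≡ (D ∖N[ r ]) u ∨ lowerNeighbours r u
  neighbourhood-split D r closed (r∈D , r-top) u with u ≟ r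
  ... | yes refl rewrite adj-irrefl u = sym (trans (∨-identityʳ _) (∧-identityʳ _))
  ... | no u≢r with adj u r in u∼r
  ...   | false = sym (trans (∨-identityʳ _) (∧-identityʳ _))
  ...   | true  = trans (∧-identityʳ (D u))
                        (trans (true-ext below (λ u≤r → closed r u r∈D u≤r)) (sym (cong (_∨ le u r) (∧-zeroʳ _))))
    where
    below : D u ≡ true → le u r ≡ true
    below u∈D with adj-comparable u r u∼r
    ... | inj₁ u≤r = u≤r
    ... | inj₂ r≤u = ⊥-elim (u≢r (r-top u u∈D r≤u))

  ∖N-lowerNeighbours-disjoint : ∀ D r u → (D ∖N[ r ]) u ∧ lowerNeighbours r u ≡ false
  ∖N-lowerNeighbours-disjoint D r u with adj u r
  ... | true  = cong (_∧ le u r) (∧-zeroʳ ((D ─ r) u))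
  ... | false = ∧-zeroʳ _

module Construction (R : RealNumbers) {n : ℕ} (G : Graph n) (T : TreeOrder n) (LH : Lefthanded G T)
                    (p : Fin n → RealNumbers.Carrier R)
                    (p≥0 : ∀ v → RealNumbers._≤_ R (RealNumbers.0# R) (p v))
                    (σ≥0 : ∀ S → RealNumbers._≤_ R (RealNumbers.0# R) (AlternatingSums.σ[_] R G p (λ _ → true) S))
                    (Z>0 : RealNumbers._<_ R (RealNumbers.0# R) (AlternatingSums.Z R G p (λ _ → true)))
                    where
  open OrderedField R
  open Sums R using (prodWhere)
  open BigOperators R
  open Independence G
  open AlternatingSums R G p
  open Positivity R G p
  open TreeStructure G T LH
  open TreeOrder T using () renaming (refl to ≤ᵗ-refl)

  Z-pos : ∀ W → 0# < Z W
  Z-pos W = <-≤-pos Z>0 (proj₂ (positivity σ≥0 W))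

  Z-nonneg : ∀ W → 0# ≤ Z W
  Z-nonneg W = proj₁ (positivity σ≥0 W) ⊥

  inv : Fin n → Carrier
  inv v = proj₁ (inverse (Z ((↓ v) ─ v)) (λ Z≡0 → proj₂ (Z-pos ((↓ v) ─ v)) (sym Z≡0)))

  inv-spec : ∀ v → Z ((↓ v) ─ v) * inv v ≡ 1#
  inv-spec v = proj₂ (inverse (Z ((↓ v) ─ v)) (λ Z≡0 → proj₂ (Z-pos ((↓ v) ─ v)) (sym Z≡0)))

  x : Fin n → Carrier
  x v = 1# - Z (↓ v) * inv v

  -- By the deletion recurrence at v in ↓v: x_v = p_v Z(↓v ∖ N[v]) / Z(↓v - v).
  x-formula : ∀ v → x v ≡ (p v * Z ((↓ v) ∖N[ v ])) * inv v
  x-formula v = 1-quotient _ _ _ (inv v) (deletion (↓ v) v (≤ᵗ-refl v)) (inv-spec v)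

  x-bounds : ∀ v → 0# ≤ x v × x v ≤ 1#
  x-bounds v = subst (0# ≤_) (sym (x-formula v)) (*-nonneg _ _ (*-nonneg _ _ (p≥0 v) (Z-nonneg _)) inv≥0)
             , 0≤-⇒≤ (subst (0# ≤_) (sym (a-[a-t] 1# (Z (↓ v) * inv v))) (*-nonneg _ _ (Z-nonneg _) inv≥0))
    where
    inv≥0 : 0# ≤ inv v
    inv≥0 = inverse-nonneg (Z-pos _) (inv-spec v)

  ω : Fin n → Carrier
  ω u = 1# - x u

  lowerProduct : Fin n → Carrier
  lowerProduct v = prodWhere (lowerNeighbours v) ω

  ProductFormula : (Fin n → Bool) → Set
  ProductFormula D = Z D ≡ prodWhere D ω

  product-split : ∀ D r → DownClosed D → Maximal D r →
                  prodWhere (D ─ r) ω ≡ prodWhere (D ∖N[ r ]) ω * lowerProduct r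
  product-split D r closed r-max =
    prodWhere-⊔ (D ─ r) (D ∖N[ r ]) (lowerNeighbours r) ω
                (neighbourhood-split D r closed r-max) (∖N-lowerNeighbours-disjoint D r)

  product-remove : ∀ D r → D r ≡ true → prodWhere D ω ≡ prodWhere (D ─ r) ω * ω r
  product-remove D r r∈D =
    trans (prodWhere-⊔ D (D ─ r) (_≡ᵇ r) ω split disjoint) (cong (prodWhere (D ─ r) ω *_) (prodWhere-single r ω))
    where
    split : ∀ u → D u ≡ (D ─ r) u ∨ (u ≡ᵇ r)
    split u with u ≟ r
    ... | yes refl = trans r∈D (sym (∨-zeroʳ _))
    ... | no _     = sym (trans (∨-identityʳ _) (∧-identityʳ _))
    disjoint : ∀ u → (D ─ r) u ∧ (u ≡ᵇ r) ≡ false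
    disjoint u with u ≟ r
    ... | yes refl = trans (∧-identityʳ _) (∧-zeroʳ (D u))
    ... | no _     = ∧-zeroʳ _

  p-from-products : ∀ v → ProductFormula ((↓ v) ─ v) → ProductFormula ((↓ v) ∖N[ v ]) →
                    p v ≡ x v * lowerProduct v
  p-from-products v Z⁻ Zᴺ =
    sym (begin
      x v * Π
    ≡⟨ cong (_* Π) (x-formula v) ⟩
      ((p v * Z ((↓ v) ∖N[ v ])) * inv v) * Π
    ≡⟨ regroup (p v) (Z ((↓ v) ∖N[ v ])) (inv v) Π ⟩
      p v * ((Z ((↓ v) ∖N[ v ]) * Π) * inv v)
    ≡⟨ cong (λ z → p v * (z * inv v)) (sym Z↓⁻≡) ⟩
      p v * (Z ((↓ v) ─ v) * inv v)
    ≡⟨ trans (cong (p v *_) (inv-spec v)) (*-identityʳ (p v)) ⟩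
      p v
    ∎)
    where
    open ≡-Reasoning
    Π = lowerProduct v
    regroup : ∀ a c y π → ((a * c) * y) * π ≡ a * ((c * π) * y)
    regroup a c y π = trans (*-assoc (a * c) y π)
                            (trans (*-assoc a c (y * π)) (cong (a *_) (trans (cong (c *_) (*-comm y π)) (sym (*-assoc c π y)))))
    Z↓⁻≡ : Z ((↓ v) ─ v) ≡ Z ((↓ v) ∖N[ v ]) * Π
    Z↓⁻≡ = trans Z⁻ (trans (product-split (↓ v) v (↓-closed v) (↓-maximal v)) (cong (_* Π) (sym Zᴺ)))

  product-formula-step : ∀ D r → DownClosed D → Maximal D r →
                         ProductFormula (D ─ r) → ProductFormula (D ∖N[ r ]) → p r ≡ x r * lowerProduct r →
                         ProductFormula D
  product-formula-step D r closed r-max Z⁻ Zᴺ p-factor =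
    begin
      Z D
    ≡⟨ deletion D r (proj₁ r-max) ⟩
      Z (D ─ r) - p r * Z (D ∖N[ r ])
    ≡⟨ cong₂ (λ a b → a - p r * b) (trans Z⁻ (product-split D r closed r-max)) Zᴺ ⟩
      Q * Π - p r * Q
    ≡⟨ cong (λ b → Q * Π - b * Q) p-factor ⟩
      Q * Π - (x r * Π) * Q
    ≡⟨ cong (λ b → Q * Π - b) (trans (*-assoc (x r) Π Q) (cong (x r *_) (*-comm Π Q))) ⟩
      Q * Π - x r * (Q * Π)
    ≡⟨ factor-1- (Q * Π) (x r) ⟩
      (Q * Π) * ω r
    ≡⟨ cong (_* ω r) (sym (product-split D r closed r-max)) ⟩
      prodWhere (D ─ r) ω * ω r
    ≡⟨ sym (product-remove D r (proj₁ r-max)) ⟩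
      prodWhere D ω
    ∎
    where
    open ≡-Reasoning
    Π = lowerProduct r
    Q = prodWhere (D ∖N[ r ]) ω

  -- Z(D) = ∏_{u∈D} (1 - x_u) for every down-closed D, by strong induction on
  -- |D|: at a maximal r, the four sets D - r, D ∖ N[r], ↓r - r and ↓r ∖ N[r]
  -- are down-closed, contained in D and miss r.
  product-formula : ∀ D → DownClosed D → ProductFormula D
  product-formula D closed = go (suc (size D)) D closed (ℕₚ.n<1+n _)
    where
    go : ∀ bound D → DownClosed D → size D <ℕ bound → ProductFormula D
    go (suc bound) D closed small with any? (λ u → D u Bool.≟ true)
    ... | no empty = trans (Z-empty D none) (sym (prodWhere-empty D ω none))
      where
      none : ∀ u → D u ≡ false
      none u = ¬-not (λ Du≡true → empty (u , Du≡true))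
    ... | yes (d , d∈D) with maximal-exists D d d∈D
    ...   | r , r-max@(r∈D , _) =
      product-formula-step D r closed r-max
        (IH (D ─ r) (─-closed D r closed r-max) (─-⊑ D r) (─-self D r))
        (IH (D ∖N[ r ]) (∖N-closed D r closed r-max) (λ u → ─-⊑ D r u ∘ ∖N-⊑ D r u) (∖N-self D r))
        (p-from-products r
          (IH ((↓ r) ─ r) (─-closed (↓ r) r (↓-closed r) (↓-maximal r))
              (λ u → ↓r⊑D u ∘ ─-⊑ (↓ r) r u) (─-self (↓ r) r))
          (IH ((↓ r) ∖N[ r ]) (∖N-closed (↓ r) r (↓-closed r) (↓-maximal r))
              (λ u → ↓r⊑D u ∘ ─-⊑ (↓ r) r u ∘ ∖N-⊑ (↓ r) r u) (∖N-self (↓ r) r)))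
      where
      ↓r⊑D : (↓ r) ⊑ D
      ↓r⊑D u u≤r = closed r u r∈D u≤r
      IH : ∀ E → DownClosed E → E ⊑ D → E r ≡ false → ProductFormula E
      IH E E-closed E⊑D r∉E = go bound E E-closed (ℕₚ.<-≤-trans (size-< E⊑D r∈D r∉E) (ℕₚ.≤-pred small))

  p-factorisation : ∀ v → p v ≡ x v * lowerProduct v
  p-factorisation v =
    p-from-products v (product-formula ((↓ v) ─ v) (─-closed (↓ v) v (↓-closed v) (↓-maximal v)))
                      (product-formula ((↓ v) ∖N[ v ]) (∖N-closed (↓ v) v (↓-closed v) (↓-maximal v)))

  total-product : prodWhere everything ω ≡ Z everything
  total-product = sym (product-formula everything (λ _ _ _ _ → refl))

mainTheorem1 : (R : RealNumbers) (n : ℕ) (G : Graph n) (T : TreeOrder n) →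
    Lefthanded G T →
    (p : Fin n → RealNumbers.Carrier R) →
    (∀ v → RealNumbers._≤_ R (RealNumbers.0# R) (p v) × RealNumbers._≤_ R (p v) (RealNumbers.1# R)) →
    (∀ (S : Subset n) → RealNumbers._≤_ R (RealNumbers.0# R) (Sums.σ R G p S)) →
    RealNumbers._<_ R (RealNumbers.0# R) (Sums.σ R G p ⊥) →
    ∃ λ (x : Fin n → RealNumbers.Carrier R) →
      (∀ v → RealNumbers._≤_ R (RealNumbers.0# R) (x v) × RealNumbers._≤_ R (x v) (RealNumbers.1# R))
      × (∀ v → p v ≡ RealNumbers._*_ R (x v)
                 (Sums.prodWhere R (λ u → Graph.adj G u v ∧ TreeOrder.le T u v)
                                   (λ u → RealNumbers._-_ R (RealNumbers.1# R) (x u))))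
      × Sums.prodWhere R (λ _ → true) (λ v → RealNumbers._-_ R (RealNumbers.1# R) (x v))
          ≡ Sums.σ R G p ⊥
mainTheorem1 R n G T LH p p∈[0,1] σ≥0 σ∅>0 =
  x , x-bounds , p-factorisation , trans total-product (sym (σ-everything ⊥))
  where
  open RealNumbers R using (_≤_; _<_; 0#)
  open AlternatingSums R G p using (σ-everything)
  open Construction R G T LH p (proj₁ ∘ p∈[0,1])
                    (λ S → subst (0# ≤_) (σ-everything S) (σ≥0 S))
                    (subst (0# <_) (σ-everything ⊥) σ∅>0)
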